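{- Let $m$ be a positive integer admitting a $t$-squared partition, and let $M\in\mathcal{M}_0$ be a matrix associated to it, so that $P(M)=m$. Let $n$ be a positive integer. If $\ell(M)\le n$, then $m\le n^2$.
   Context: $\mathcal{M}$ is the set of all two-line matrices $M=\begin{pmatrix} c_1 & \cdots & c_s\\ d_1 & \cdots & d_s\end{pmatrix}$ ($s\ge1$) with non-negative integer entries satisfying $c_s=0$, $d_s\ne0$, and $c_j=c_{j+1}+d_{j+1}$ for $1\le j\le s-1$; $\mathcal{M}_0$ is the subset of those with $d_1=0$. $\ell(M)$ denotes the sum of all entries of $M$. With $N=\ell(M)-d_1$, $P(M)$ is the sum of the numbers $2\big(N-(d_2+\cdots+d_k)-(c_1+\cdots+c_{k-1})-i\big)-1$ over $k=1,\ldots,s-1$ and $i=0,\ldots,c_k-1$. A $t$-squared partition of $m$ is a representation $m=b^2+2(c_1^2+\cdots+c_t^2)$ with $b=c_1+\cdots+c_t$, $c_i$ positive integers; the matrix associated to such a partition (written with $c_1\ge\cdots\ge c_t$) is the unique $M\in\mathcal{M}_0$ with $s=t+1$ and first row $(c_1,\ldots,c_t,0)$. -}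

module Defs where

open import Data.Nat using (ℕ; zero; suc; _+_; _*_; _^_; _≤_; _<_; _≥_)
open import Data.Fin using (Fin; zero; suc; fromℕ; inject₁) renaming (_≤_ to _Fin≤_)
open import Data.Product using (_×_)
open import Relation.Binary.PropositionalEquality using (_≡_; _≢_)

sumF : ∀ {n} → (Fin n → ℕ) → ℕ
sumF {zero}  f = 0
sumF {suc n} f = f zero + sumF (λ i → f (suc i))

-- A two-line matrix with s = suc k columns; column indices 0..k
-- correspond to the paper's 1..s.
record Mat (k : ℕ) : Set where
  field
    c : Fin (suc k) → ℕ
    d : Fin (suc k) → ℕ
open Mat public

InM : ∀ {k} → Mat k → Set
InM {k} M =
  (c M (fromℕ k) ≡ 0) × (d M (fromℕ k) ≢ 0) ×
  ((j : Fin k) → c M (inject₁ j) ≡ c M (suc j) + d M (suc j))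

InM0 : ∀ {k} → Mat k → Set
InM0 M = InM M × (d M zero ≡ 0)

ℓ : ∀ {k} → Mat k → ℕ
ℓ M = sumF (c M) + sumF (d M)

IsTSquaredPartition : (m t : ℕ) → (Fin t → ℕ) → Set
IsTSquaredPartition m t cs =
  ((i : Fin t) → 1 ≤ cs i) ×
  ((i : Fin t) → (j : Fin t) → i Fin≤ j → cs j ≤ cs i) ×
  (m ≡ sumF cs ^ 2 + 2 * sumF (λ i → cs i ^ 2))

IsAssociated : (t : ℕ) → (Fin t → ℕ) → Mat t → Set
IsAssociated t cs M =
  InM0 M × ((i : Fin t) → c M (inject₁ i) ≡ cs i) × (c M (fromℕ t) ≡ 0)

-- For a t-squared partition m = b² + 2(c₁² + ⋯ + c_t²), b = c₁ + ⋯ + c_t,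
-- with associated matrix M, we show ℓ(M) = b + c₁; then, as every cᵢ ≤ c₁,
--   m ≤ b² + 2·c₁·b ≤ (b + c₁)² = ℓ(M)² ≤ n².
module Submission where

open import Defs
open import Data.Nat using (ℕ; zero; suc; _+_; _*_; _^_; _≤_; _<_; z≤n)
open import Data.Nat.Properties
open import Data.Nat.Solver using (module +-*-Solver)
open import Data.Fin using (Fin; zero; suc; fromℕ; inject₁)
open import Data.Product using (_,_)
open import Relation.Binary.PropositionalEquality

sumF-cong : ∀ {k} (f g : Fin k → ℕ) → (∀ i → f i ≡ g i) → sumF f ≡ sumF g
sumF-cong {zero}  f g f≡g = refl
sumF-cong {suc k} f g f≡g =
  cong₂ _+_ (f≡g zero) (sumF-cong (λ i → f (suc i)) (λ i → g (suc i)) (λ i → f≡g (suc i)))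

sumF-last : ∀ k (f : Fin (suc k) → ℕ) →
  sumF f ≡ sumF (λ i → f (inject₁ i)) + f (fromℕ k)
sumF-last zero    f = +-identityʳ (f zero)
sumF-last (suc k) f = begin
  f zero + sumF (λ i → f (suc i))
    ≡⟨ cong (f zero +_) (sumF-last k (λ i → f (suc i))) ⟩
  f zero + (sumF (λ i → f (suc (inject₁ i))) + f (fromℕ (suc k)))
    ≡⟨ +-assoc (f zero) _ _ ⟨
  sumF (λ i → f (inject₁ i)) + f (fromℕ (suc k)) ∎
  where open ≡-Reasoning

telescope : ∀ k (c d : Fin (suc k) → ℕ) →
  ((j : Fin k) → c (inject₁ j) ≡ c (suc j) + d (suc j)) →
  c zero ≡ c (fromℕ k) + sumF (λ i → d (suc i))
telescope zero    c d rel = sym (+-identityʳ (c zero))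
telescope (suc k) c d rel = begin
  c zero
    ≡⟨ rel zero ⟩
  c (suc zero) + d (suc zero)
    ≡⟨ cong (_+ d (suc zero)) tail ⟩
  c (fromℕ (suc k)) + sumF d₂₊ + d (suc zero)
    ≡⟨ +-assoc (c (fromℕ (suc k))) (sumF d₂₊) (d (suc zero)) ⟩
  c (fromℕ (suc k)) + (sumF d₂₊ + d (suc zero))
    ≡⟨ cong (c (fromℕ (suc k)) +_) (+-comm (sumF d₂₊) (d (suc zero))) ⟩
  c (fromℕ (suc k)) + sumF (λ i → d (suc i)) ∎
  where
  open ≡-Reasoning
  d₂₊ : Fin k → ℕ
  d₂₊ i = d (suc (suc i))
  tail : c (suc zero) ≡ c (fromℕ (suc k)) + sumF d₂₊
  tail = telescope k (λ i → c (suc i)) (λ i → d (suc i)) (λ j → rel (suc j))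

-- In a matrix of 𝓜 the second row sums to d₁ + c₁ (as c_s = 0).
secondRow-sum : ∀ {k} (M : Mat k) → InM M → sumF (d M) ≡ d M zero + c M zero
secondRow-sum {k} M (cₛ≡0 , _ , rel) = cong (d M zero +_) (begin
  sumF (λ i → d M (suc i))
    ≡⟨ cong (_+ sumF (λ i → d M (suc i))) cₛ≡0 ⟨
  c M (fromℕ k) + sumF (λ i → d M (suc i))
    ≡⟨ telescope k (c M) (d M) rel ⟨
  c M zero ∎)
  where open ≡-Reasoning

associated-length : ∀ t (cs : Fin (suc t) → ℕ) (M : Mat (suc t)) →
  IsAssociated (suc t) cs M → ℓ M ≡ sumF cs + cs zero
associated-length t cs M ((M∈𝓜 , d₁≡0) , c≡cs , cₛ≡0) = cong₂ _+_ firstRow secondRow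
  where
  open ≡-Reasoning
  firstRow : sumF (c M) ≡ sumF cs
  firstRow = begin
    sumF (c M)                                    ≡⟨ sumF-last (suc t) (c M) ⟩
    sumF (λ i → c M (inject₁ i)) + c M (fromℕ (suc t))
      ≡⟨ cong (sumF (λ i → c M (inject₁ i)) +_) cₛ≡0 ⟩
    sumF (λ i → c M (inject₁ i)) + 0             ≡⟨ +-identityʳ _ ⟩
    sumF (λ i → c M (inject₁ i))                  ≡⟨ sumF-cong _ cs c≡cs ⟩
    sumF cs ∎
  secondRow : sumF (d M) ≡ cs zero
  secondRow = begin
    sumF (d M)             ≡⟨ secondRow-sum M M∈𝓜 ⟩
    d M zero + c M zero    ≡⟨ cong₂ _+_ d₁≡0 (c≡cs zero) ⟩
    cs zero ∎

sumSquares≤ : ∀ {k} (a : ℕ) (f : Fin k → ℕ) → (∀ i → f i ≤ a) →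
  sumF (λ i → f i ^ 2) ≤ a * sumF f
sumSquares≤ {zero}  a f f≤a = z≤n
sumSquares≤ {suc k} a f f≤a = begin
  f zero ^ 2 + sumF (λ i → f (suc i) ^ 2)
    ≤⟨ +-mono-≤ head (sumSquares≤ a (λ i → f (suc i)) (λ i → f≤a (suc i))) ⟩
  a * f zero + a * sumF (λ i → f (suc i))
    ≡⟨ *-distribˡ-+ a (f zero) _ ⟨
  a * sumF f ∎
  where
  open ≤-Reasoning
  head : f zero ^ 2 ≤ a * f zero
  head = begin
    f zero * (f zero * 1)  ≡⟨ cong (f zero *_) (*-identityʳ (f zero)) ⟩
    f zero * f zero        ≤⟨ *-monoˡ-≤ (f zero) (f≤a zero) ⟩
    a * f zero ∎

square-bound : ∀ a b S → S ≤ a * b → b ^ 2 + 2 * S ≤ (b + a) ^ 2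
square-bound a b S S≤ab = begin
  b ^ 2 + 2 * S                  ≤⟨ +-monoʳ-≤ (b ^ 2) (*-monoʳ-≤ 2 S≤ab) ⟩
  b ^ 2 + 2 * (a * b)            ≤⟨ m≤m+n _ (a * a) ⟩
  b ^ 2 + 2 * (a * b) + a * a    ≡⟨ expand ⟩
  (b + a) ^ 2 ∎
  where
  open ≤-Reasoning
  open +-*-Solver
  expand : b ^ 2 + 2 * (a * b) + a * a ≡ (b + a) ^ 2
  expand = solve 2 (λ b a → b :^ 2 :+ con 2 :* (a :* b) :+ a :* a := (b :+ a) :^ 2) refl b a

square-mono : ∀ {x y} → x ≤ y → x ^ 2 ≤ y ^ 2
square-mono x≤y = *-mono-≤ x≤y (*-monoˡ-≤ 1 x≤y)

lemma3p4 : (m t : ℕ) → (cs : Fin t → ℕ) → 0 < m → IsTSquaredPartition m t cs →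
    (M : Mat t) → IsAssociated t cs M →
    (n : ℕ) → 0 < n → ℓ M ≤ n → m ≤ n ^ 2
lemma3p4 m zero cs _ (_ , _ , m≡0) M _ n _ _ = ≤-trans (≤-reflexive m≡0) z≤n
lemma3p4 m (suc t) cs _ (_ , decreasing , m≡) M assoc n _ ℓ≤n = begin
  m                                   ≡⟨ m≡ ⟩
  b ^ 2 + 2 * sumF (λ i → cs i ^ 2)   ≤⟨ square-bound c₁ b _ (sumSquares≤ c₁ cs cᵢ≤c₁) ⟩
  (b + c₁) ^ 2                        ≡⟨ cong (_^ 2) (associated-length t cs M assoc) ⟨
  ℓ M ^ 2                             ≤⟨ square-mono ℓ≤n ⟩
  n ^ 2 ∎
  where
  open ≤-Reasoning
  b c₁ : ℕ
  b  = sumF cs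
  c₁ = cs zero
  cᵢ≤c₁ : ∀ i → cs i ≤ c₁
  cᵢ≤c₁ i = decreasing zero i z≤n
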